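{- A simplicial complex $K$ is eulerian if and only if $K=\mathrm{Ind}(C)$ for some eulerian clutter $C$, equivalently, if and only if the clutter $C(K)$ of minimal nonfaces of $K$ is eulerian.
   Context: A simplicial complex $K$ on a finite vertex set $V$ is a family of subsets of $V$ closed under taking subsets and containing all singletons $\{v\}$, $v\in V$; $K|_I=\{\sigma\in K:\sigma\subseteq I\}$; $K$ is a simplex if it contains all subsets of $V$. With $\zeta_{\mathbf K}(K)=1$ if $K$ is a simplex and $0$ otherwise, $\epsilon(K)=1$ iff $V=\emptyset$, and $\chi_{\mathbf K}(K)=\sum_{I\subseteq V}(-1)^{|I|}\zeta_{\mathbf K}(K|_I)\zeta_{\mathbf K}(K|_{V\setminus I})$, $K$ is eulerian if $\chi_{\mathbf K}(K|_I)=\epsilon(K|_I)$ for all $I\subseteq V$. A clutter $C$ on $V$ is a family of subsets of $V$, each of size at least two, forming an antichain; it is discrete if it has no edges; $C|_I=\{e\in C:e\subseteq I\}$. With $\zeta(C)=1$ if $C$ is discrete and $0$ otherwise, $\epsilon(C)=1$ iff $V=\emptyset$, and $\chi(C)=\sum_{I\subseteq V}(-1)^{|I|}\zeta(C|_I)\zeta(C|_{V\setminus I})$, $C$ is eulerian if $\chi(C|_I)=\epsilon(C|_I)$ for all $I\subseteq V$. The independence complex of $C$ is $\mathrm{Ind}(C)=\{I\subseteq V: C|_I\text{ is discrete}\}$, and $C(K)$ is the clutter on $V$ of inclusion-minimal subsets of $V$ not in $K$. -}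

module Defs where

open import Data.Bool using (Bool; true; false; not; _∧_; _∨_)
open import Data.Nat using (ℕ; zero; suc; _≤_)
open import Data.Integer using (ℤ; +_; _*_; -_)
open import Data.Fin using (Fin)
open import Data.Fin.Subset using (Subset; _⊆_; _─_; ∣_∣; ⁅_⁆; ⊥; inside; outside)
open import Data.Fin.Subset.Properties using (_⊆?_)
open import Data.List using (List; []; _∷_; map; _++_; filter; foldr)
open import Data.Bool.ListAction using (all; any)
open import Data.Vec using (_∷_; [])
open import Data.Vec.Properties using (≡-dec)
import Data.Bool.Properties as BoolP
open import Data.Product using (Σ; _×_)
open import Relation.Nullary.Decidable using (⌊_⌋)
open import Relation.Binary.PropositionalEquality using (_≡_)

-- Vertex set V = Fin n; subsets of V are Data.Fin.Subset n.
-- Families of subsets (complexes, clutters) are Bool-valued predicates.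
Family : ℕ → Set
Family n = Subset n → Bool

subsets : (n : ℕ) → List (Subset n)
subsets zero = [] ∷ []
subsets (suc n) = map (outside ∷_) (subsets n) ++ map (inside ∷_) (subsets n)

_⊆ᵇ_ : {n : ℕ} → Subset n → Subset n → Bool
σ ⊆ᵇ τ = ⌊ σ ⊆? τ ⌋

_≡ᵇ_ : {n : ℕ} → Subset n → Subset n → Bool
σ ≡ᵇ τ = ⌊ ≡-dec BoolP._≟_ σ τ ⌋

isEmptyᵇ : {n : ℕ} → Subset n → Bool
isEmptyᵇ σ = σ ≡ᵇ ⊥

subsetsOf : {n : ℕ} → Subset n → List (Subset n)
subsetsOf {n} I = filter (λ J → J ⊆? I) (subsets n)

sumℤ : List ℤ → ℤ
sumℤ = foldr Data.Integer._+_ (+ 0)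

b2z : Bool → ℤ
b2z true = + 1
b2z false = + 0

sign : ℕ → ℤ
sign zero = + 1
sign (suc k) = - sign k

IsSimplicialComplex : {n : ℕ} → Family n → Set
IsSimplicialComplex {n} K =
  (∀ (σ τ : Subset n) → τ ⊆ σ → K σ ≡ true → K τ ≡ true)
  × (∀ (v : Fin n) → K ⁅ v ⁆ ≡ true)
  × (K ⊥ ≡ true)

-- ζ_K(K|_I): K|_I is a simplex, i.e. contains all subsets of I
ζK : {n : ℕ} → Family n → Subset n → Bool
ζK K I = all K (subsetsOf I)

ε : {n : ℕ} → Subset n → ℤ
ε I = b2z (isEmptyᵇ I)

χK : {n : ℕ} → Family n → Subset n → ℤ
χK K I = sumℤ (map (λ J → sign ∣ J ∣ * (b2z (ζK K J) * b2z (ζK K (I ─ J)))) (subsetsOf I))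

EulerianComplex : {n : ℕ} → Family n → Set
EulerianComplex {n} K = ∀ (I : Subset n) → χK K I ≡ ε I

IsClutter : {n : ℕ} → Family n → Set
IsClutter {n} C =
  (∀ (e : Subset n) → C e ≡ true → 2 ≤ ∣ e ∣)
  × (∀ (e f : Subset n) → C e ≡ true → C f ≡ true → e ⊆ f → e ≡ f)

-- ζ(C|_I): C|_I is discrete, i.e. no edge of C is contained in I
ζC : {n : ℕ} → Family n → Subset n → Bool
ζC C I = not (any C (subsetsOf I))

χC : {n : ℕ} → Family n → Subset n → ℤ
χC C I = sumℤ (map (λ J → sign ∣ J ∣ * (b2z (ζC C J) * b2z (ζC C (I ─ J)))) (subsetsOf I))

EulerianClutter : {n : ℕ} → Family n → Set
EulerianClutter {n} C = ∀ (I : Subset n) → χC C I ≡ ε I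

Ind : {n : ℕ} → Family n → Family n
Ind C I = ζC C I

minimalNonfaces : {n : ℕ} → Family n → Family n
minimalNonfaces K σ =
  not (K σ) ∧ all (λ τ → (τ ≡ᵇ σ) ∨ K τ) (subsetsOf σ)

-- The Euler characteristics of a complex and of a clutter are the same expression in
-- a ζ-function on subsets of V: "K|_J is a simplex" for K, "C|_J is discrete" for C.
-- By down-closure K|_J is a simplex exactly when J ∈ K, and C|_J is discrete exactly
-- when J ∈ Ind(C).  So if K = Ind(C) the two ζ-functions agree pointwise, hence so do
-- the Euler characteristics of all restrictions, and K is eulerian iff C is.  The
-- clutter C(K) is such a C: every nonface contains a minimal nonface, so Ind(C(K)) = K,
-- and C(K) is a clutter because ∅ and the singletons are faces.
module Submission where

open import Defs
open import Data.Bool using (Bool; true; false; not; T; T?; _∨_)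
open import Data.Bool.Properties using (_≟_; T-≡; ¬-not; not-¬; ∨-conicalˡ; ∨-conicalʳ)
open import Data.Nat using (ℕ; _≤_; s≤s; _≤?_)
open import Data.Nat.Properties using (≰⇒>; ≤-pred)
open import Data.Integer using (ℤ; _*_)
import Data.Fin as Fin
open import Data.Fin.Subset using (Subset; _⊆_; _⊂_; _─_; ∣_∣; ⁅_⁆; ⊥; inside; outside)
open import Data.Fin.Subset.Properties
  using (_⊆?_; ⊆-refl; ⊆-trans; drop-∷-⊆; out⊂; out⊂in; in⊂in; p⊂q⇒p⊆q; ⊂-irref)
open import Data.Fin.Subset.Induction using (⊂-wellFounded; Acc; acc)
open import Data.List using (map)
open import Data.Bool.ListAction using (all; any)
open import Data.List.Membership.Propositional using (_∈_; find; lose)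
open import Data.List.Membership.Propositional.Properties
  using (∈-map⁺; ∈-++⁺ˡ; ∈-++⁺ʳ; ∈-filter⁺; ∈-filter⁻)
open import Data.List.Relation.Unary.Any using (here)
open import Data.List.Relation.Unary.All using (lookup; tabulate)
open import Data.List.Relation.Unary.All.Properties using (all⁺; all⁻; ¬All⇒Any¬)
open import Data.List.Relation.Unary.Any.Properties using (any⁺; any⁻)
open import Data.List.Properties using (map-cong)
open import Data.Vec using (_∷_; [])
import Data.Vec as Vec
open import Data.Vec.Properties using (≡-dec)
open import Data.Product using (Σ; _×_; _,_; proj₁; proj₂; ∃-syntax)
open import Data.Sum using (_⊎_; inj₁; inj₂)
open import Function using (_∘_)
open import Function.Bundles using (_⇔_; mk⇔; Equivalence)
open import Relation.Nullary using (yes; no; contradiction)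
open import Relation.Nullary.Decidable using (isYes≗does; dec-true; dec-false)
open import Relation.Binary.PropositionalEquality
  using (_≡_; _≢_; _≗_; refl; sym; trans; cong; cong₂; subst)

open Equivalence using (to; from)

private
  variable
    n : ℕ
    I J : Subset n
    p : Subset n → Bool
    K C : Family n

∈-subsets : (J : Subset n) → J ∈ subsets n
∈-subsets []            = here refl
∈-subsets (outside ∷ J) = ∈-++⁺ˡ (∈-map⁺ (outside ∷_) (∈-subsets J))
∈-subsets (inside ∷ J)  = ∈-++⁺ʳ _ (∈-map⁺ (inside ∷_) (∈-subsets J))

∈-subsetsOf⁺ : J ⊆ I → J ∈ subsetsOf I
∈-subsetsOf⁺ {J = J} {I} = ∈-filter⁺ (_⊆? I) (∈-subsets J)

∈-subsetsOf⁻ : J ∈ subsetsOf I → J ⊆ I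
∈-subsetsOf⁻ {I = I} = proj₂ ∘ ∈-filter⁻ (_⊆? I) {xs = subsets _}

all-subsetsOf⁺ : (∀ {J} → J ⊆ I → p J ≡ true) → all p (subsetsOf I) ≡ true
all-subsetsOf⁺ {p = p} h = to T-≡ (all⁻ p (tabulate (from T-≡ ∘ h ∘ ∈-subsetsOf⁻)))

all-subsetsOf⁻ : all p (subsetsOf I) ≡ true → J ⊆ I → p J ≡ true
all-subsetsOf⁻ {p = p} h J⊆I = to T-≡ (lookup (all⁺ p _ (from T-≡ h)) (∈-subsetsOf⁺ J⊆I))

all-subsetsOf-false : all p (subsetsOf I) ≡ false → ∃[ J ] J ⊆ I × p J ≡ false
all-subsetsOf-false {p = p} {I = I} h =
  let J , J∈ , ¬pJ = find (¬All⇒Any¬ (T? ∘ p) (subsetsOf I) (subst T h ∘ all⁻ p))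
  in J , ∈-subsetsOf⁻ J∈ , ¬-not (¬pJ ∘ from T-≡)

any-subsetsOf⁺ : J ⊆ I → p J ≡ true → any p (subsetsOf I) ≡ true
any-subsetsOf⁺ {p = p} J⊆I pJ = to T-≡ (any⁺ p (lose (∈-subsetsOf⁺ J⊆I) (from T-≡ pJ)))

any-subsetsOf⁻ : any p (subsetsOf I) ≡ true → ∃[ J ] J ⊆ I × p J ≡ true
any-subsetsOf⁻ {p = p} {I = I} h =
  let J , J∈ , pJ = find (any⁻ p (subsetsOf I) (from T-≡ h))
  in J , ∈-subsetsOf⁻ J∈ , to T-≡ pJ

⊆∧≢⇒⊂ : J ⊆ I → J ≢ I → J ⊂ I
⊆∧≢⇒⊂ {J = []}          {[]}          _   J≢I = contradiction refl J≢I
⊆∧≢⇒⊂ {J = outside ∷ J} {outside ∷ I} J⊆I J≢I = out⊂ (⊆∧≢⇒⊂ (drop-∷-⊆ J⊆I) (J≢I ∘ cong (outside ∷_)))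
⊆∧≢⇒⊂ {J = outside ∷ J} {inside ∷ I}  J⊆I _   = out⊂in (drop-∷-⊆ J⊆I)
⊆∧≢⇒⊂ {J = inside ∷ J}  {outside ∷ I} J⊆I _   = contradiction (J⊆I Vec.here) λ ()
⊆∧≢⇒⊂ {J = inside ∷ J}  {inside ∷ I}  J⊆I J≢I = in⊂in (⊆∧≢⇒⊂ (drop-∷-⊆ J⊆I) (J≢I ∘ cong (inside ∷_)))

∣p∣≤0⇒p≡⊥ : (J : Subset n) → ∣ J ∣ ≤ 0 → J ≡ ⊥
∣p∣≤0⇒p≡⊥ []            _ = refl
∣p∣≤0⇒p≡⊥ (outside ∷ J) h = cong (outside ∷_) (∣p∣≤0⇒p≡⊥ J h)

∣p∣≤1⇒p≡⊥⊎⁅x⁆ : (J : Subset n) → ∣ J ∣ ≤ 1 → J ≡ ⊥ ⊎ ∃[ v ] J ≡ ⁅ v ⁆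
∣p∣≤1⇒p≡⊥⊎⁅x⁆ []            _       = inj₁ refl
∣p∣≤1⇒p≡⊥⊎⁅x⁆ (inside ∷ J)  (s≤s h) = inj₂ (Fin.zero , cong (inside ∷_) (∣p∣≤0⇒p≡⊥ J h))
∣p∣≤1⇒p≡⊥⊎⁅x⁆ (outside ∷ J) h with ∣p∣≤1⇒p≡⊥⊎⁅x⁆ J h
... | inj₁ J≡⊥       = inj₁ (cong (outside ∷_) J≡⊥)
... | inj₂ (v , J≡v) = inj₂ (Fin.suc v , cong (outside ∷_) J≡v)

≡⇒≡ᵇ-true : I ≡ J → (I ≡ᵇ J) ≡ true
≡⇒≡ᵇ-true {I = I} {J} I≡J = trans (isYes≗does (≡-dec _≟_ I J)) (dec-true (≡-dec _≟_ I J) I≡J)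

≢⇒≡ᵇ-false : I ≢ J → (I ≡ᵇ J) ≡ false
≢⇒≡ᵇ-false {I = I} {J} I≢J = trans (isYes≗does (≡-dec _≟_ I J)) (dec-false (≡-dec _≟_ I J) I≢J)

DownClosed : Family n → Set
DownClosed {n} K = ∀ (σ τ : Subset n) → τ ⊆ σ → K σ ≡ true → K τ ≡ true

IsMinimalNonface : Family n → Subset n → Set
IsMinimalNonface K σ = K σ ≡ false × (∀ {τ} → τ ⊂ σ → K τ ≡ true)

module _ {n : ℕ} {K : Family n} where

  minimalNonfaces⁻ : minimalNonfaces K J ≡ true → IsMinimalNonface K J
  minimalNonfaces⁻ {J = J} h with K J
  ... | false = refl , λ {τ} τ⊂J →
    trans (sym (cong (_∨ K τ) (≢⇒≡ᵇ-false λ τ≡J → ⊂-irref τ≡J τ⊂J)))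
          (all-subsetsOf⁻ h (p⊂q⇒p⊆q τ⊂J))

  nonminimalNonface⇒⊂nonface : K J ≡ false → minimalNonfaces K J ≡ false → ∃[ τ ] τ ⊂ J × K τ ≡ false
  nonminimalNonface⇒⊂nonface {J = J} KJ h rewrite KJ =
    let τ , τ⊆J , q = all-subsetsOf-false h
        τ≢J : τ ≢ J
        τ≢J τ≡J = not-¬ (≡⇒≡ᵇ-true τ≡J) (∨-conicalˡ _ _ q)
    in τ , ⊆∧≢⇒⊂ τ⊆J τ≢J , ∨-conicalʳ _ _ q

  nonface⇒minimalNonface⊆ : K J ≡ false → ∃[ σ ] σ ⊆ J × minimalNonfaces K σ ≡ true
  nonface⇒minimalNonface⊆ {J = J} = go J (⊂-wellFounded J)
    where
    go : ∀ J → Acc _⊂_ J → K J ≡ false → ∃[ σ ] σ ⊆ J × minimalNonfaces K σ ≡ true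
    go J (acc smaller) KJ with minimalNonfaces K J in m
    ... | true  = J , ⊆-refl , m
    ... | false =
      let τ , τ⊂J , Kτ = nonminimalNonface⇒⊂nonface KJ m
          σ , σ⊆τ , mσ = go τ (smaller τ⊂J) Kτ
      in σ , ⊆-trans σ⊆τ (p⊂q⇒p⊆q τ⊂J) , mσ

  ζK≗ : DownClosed K → ζK K ≗ K
  ζK≗ down J with K J in KJ
  ... | true  = all-subsetsOf⁺ λ {τ} τ⊆J → down J τ τ⊆J KJ
  ... | false = ¬-not λ h → not-¬ (all-subsetsOf⁻ {p = K} h ⊆-refl) KJ

  Ind-minimalNonfaces : DownClosed K → Ind (minimalNonfaces K) ≗ K
  Ind-minimalNonfaces down J with K J in KJ
  ... | true  = cong not (¬-not λ h →
    let σ , σ⊆J , mσ = any-subsetsOf⁻ {p = minimalNonfaces K} h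
    in not-¬ (down J σ σ⊆J KJ) (proj₁ (minimalNonfaces⁻ mσ)))
  ... | false =
    let σ , σ⊆J , mσ = nonface⇒minimalNonface⊆ KJ
    in cong not (any-subsetsOf⁺ {p = minimalNonfaces K} σ⊆J mσ)

  nonface⇒2≤∣p∣ : K ⊥ ≡ true → (∀ v → K ⁅ v ⁆ ≡ true) → K J ≡ false → 2 ≤ ∣ J ∣
  nonface⇒2≤∣p∣ {J = J} K⊥ K⁅v⁆ KJ with 2 ≤? ∣ J ∣
  ... | yes 2≤∣J∣ = 2≤∣J∣
  ... | no  2≰∣J∣ with ∣p∣≤1⇒p≡⊥⊎⁅x⁆ J (≤-pred (≰⇒> 2≰∣J∣))
  ...   | inj₁ refl       = contradiction KJ (not-¬ K⊥)
  ...   | inj₂ (v , refl) = contradiction KJ (not-¬ (K⁅v⁆ v))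

  minimalNonfaces-isClutter : IsSimplicialComplex K → IsClutter (minimalNonfaces K)
  minimalNonfaces-isClutter (_ , K⁅v⁆ , K⊥) =
    (λ e me → nonface⇒2≤∣p∣ K⊥ K⁅v⁆ (proj₁ (minimalNonfaces⁻ me))) , antichain
    where
    antichain : ∀ e f → minimalNonfaces K e ≡ true → minimalNonfaces K f ≡ true → e ⊆ f → e ≡ f
    antichain e f me mf e⊆f with ≡-dec _≟_ e f
    ... | yes e≡f = e≡f
    ... | no  e≢f = contradiction (proj₁ (minimalNonfaces⁻ me))
                                  (not-¬ (proj₂ (minimalNonfaces⁻ mf) (⊆∧≢⇒⊂ e⊆f e≢f)))

-- χK K is definitionally χ (ζK K), and χC C is χ (Ind C).
χ : Family n → Subset n → ℤ
χ ζ I = sumℤ (map (λ J → sign ∣ J ∣ * (b2z (ζ J) * b2z (ζ (I ─ J)))) (subsetsOf I))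

χ-cong : {ζ ζ′ : Family n} → ζ ≗ ζ′ → χ ζ ≗ χ ζ′
χ-cong ζ≗ζ′ I = cong sumℤ (map-cong
  (λ J → cong₂ (λ a b → sign ∣ J ∣ * (b2z a * b2z b)) (ζ≗ζ′ J) (ζ≗ζ′ (I ─ J)))
  (subsetsOf I))

χK≗χC : DownClosed K → K ≗ Ind C → χK K ≗ χC C
χK≗χC down K≗IndC I = trans (χ-cong (ζK≗ down) I) (χ-cong K≗IndC I)

eulerianComplex⇔eulerianClutter : DownClosed K → K ≗ Ind C → EulerianComplex K ⇔ EulerianClutter C
eulerianComplex⇔eulerianClutter down K≗IndC =
  mk⇔ (λ eu I → trans (sym (χK≗χC down K≗IndC I)) (eu I))
      (λ eu I → trans (χK≗χC down K≗IndC I) (eu I))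

mainTheorem8 : (n : ℕ) (K : Family n) → IsSimplicialComplex K →
    (EulerianComplex K ⇔
      Σ (Family n) (λ C → IsClutter C × EulerianClutter C × (∀ (σ : Subset n) → K σ ≡ Ind C σ)))
    × (EulerianComplex K ⇔ EulerianClutter (minimalNonfaces K))
mainTheorem8 n K complex@(down , _) =
  mk⇔ (λ eu → minimalNonfaces K , minimalNonfaces-isClutter complex , to eulerianCK eu , K≗IndCK)
      (λ { (C , _ , euC , K≗IndC) → from (eulerianComplex⇔eulerianClutter down K≗IndC) euC })
  , eulerianCK
  where
  K≗IndCK : K ≗ Ind (minimalNonfaces K)
  K≗IndCK = sym ∘ Ind-minimalNonfaces down

  eulerianCK : EulerianComplex K ⇔ EulerianClutter (minimalNonfaces K)
  eulerianCK = eulerianComplex⇔eulerianClutter down K≗IndCK
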